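{- Let $R>1$ be an integer all of whose prime factors $p$ satisfy $p\equiv 1\pmod 4$, and let $\tau(R)$ denote the number of positive divisors of $R$. Then there exists an integral point set over $\mathbb{Z}^2$ consisting of $2\tau(R)$ points on a circle of radius $R$ together with the center of this circle, such that the distance between any two of the $2\tau(R)$ points on the circle is an even integer, and the diameter of the point set equals $2R$.
   Context: An integral point set over $\mathbb{Z}^2$ is a finite set of points of $\mathbb{Z}^2$, not all on one line, such that the Euclidean distance between any two of its points is an integer. The diameter of a point set is the largest distance between two of its points. -}

module Defs where

open import Data.Nat using (ℕ; suc; _*_; _≤_; _%_)
open import Data.Nat.Divisibility using (_∣_; _∣?_)
open import Data.Integer as ℤ using (ℤ; ∣_∣; _-_)
open import Data.Product using (_×_; _,_; ∃; ∃-syntax; Σ-syntax)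
open import Data.List using (List; length; filter; upTo; map)
open import Data.List.Membership.Propositional using (_∈_)
open import Data.List.Relation.Unary.Unique.Propositional using (Unique)
open import Relation.Binary.PropositionalEquality using (_≡_; _≢_)
open import Relation.Nullary using (¬_)

Point : Set
Point = ℤ × ℤ

dist² : Point → Point → ℕ
dist² (x₁ , y₁) (x₂ , y₂) =
  ∣ (x₁ - x₂) ℤ.* (x₁ - x₂) ℤ.+ (y₁ - y₂) ℤ.* (y₁ - y₂) ∣

HasDist : Point → Point → ℕ → Set
HasDist P Q d = d * d ≡ dist² P Q

Collinear : Point → Point → Point → Set
Collinear (x₁ , y₁) (x₂ , y₂) (x₃ , y₃) =
  (x₂ - x₁) ℤ.* (y₃ - y₁) ≡ (x₃ - x₁) ℤ.* (y₂ - y₁)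

IsIntegralPointSet : List Point → Set
IsIntegralPointSet S =
  Unique S
  × (∃[ P ] ∃[ Q ] ∃[ T ] (P ∈ S × Q ∈ S × T ∈ S × ¬ Collinear P Q T))
  × (∀ {P Q} → P ∈ S → Q ∈ S → ∃[ d ] HasDist P Q d)

HasDiameter : List Point → ℕ → Set
HasDiameter S D =
  (∀ {P Q} → P ∈ S → Q ∈ S → dist² P Q ≤ D * D)
  × (∃[ P ] ∃[ Q ] (P ∈ S × Q ∈ S × HasDist P Q D))

τ : ℕ → ℕ
τ n = length (filter (_∣? n) (map suc (upTo n)))

module Submission where

-- Identify ℤ² with the
-- Gaussian integers.  If N(β) = N(γ) = R then β² and γ² lie on the circle of
-- radius R about 0 and |β² - γ²| = 2 |Im(β conj γ)| is an even integer, at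
-- most 2R, with equality for γ = iβ; so 0 together with points ±β² is an
-- integral point set of diameter 2R.  For each divisor d of R let
-- α_d = γ_d · conj(γ_{R/d}), where γ_m multiplies, over the prime
-- factorisation of m, a Gaussian prime π_q of norm q fixed once for each
-- prime q ≡ 1 (mod 4) (Fermat's two-square theorem, via Zagier's involution).
-- Then N(α_d) = R, and the 2τ(R) points ±α_d² are distinct: products of the
-- π_q are primitive, so conj(γ_R)² α_d² = d² conj(γ_{R/d})⁴ has content d².

module InvolutionParity where

  open import Data.Nat using (suc; _*_; _≤_; s≤s)
  open import Data.Nat.Properties using (≤-refl; ≤-trans; n≤1+n; even≢odd)
  open import Data.Nat.Tactic.RingSolver using (solve)
  open import Function using (_∘_)
  open import Data.Product using (∃-syntax; _×_; _,_)
  open import Data.Empty using (⊥-elim)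
  open import Data.List using (List; []; _∷_; length)
  open import Data.List.Properties using (length-removeAt′)
  open import Data.List.Membership.Propositional using (_∈_; _∉_; find; lose)
  open import Data.List.Relation.Unary.Any using (here; there; _─_; any?)
  open import Data.List.Relation.Unary.All as All using ()
  open import Data.List.Relation.Unary.AllPairs using (_∷_)
  open import Data.List.Relation.Unary.Unique.Propositional using (Unique)
  open import Data.List.Relation.Unary.Unique.Propositional.Properties
    using (Unique[x∷xs]⇒x∉xs)
  open import Relation.Nullary using (Dec; yes; no)
  open import Relation.Binary.PropositionalEquality
  open ≡-Reasoning

  module _ {A : Set} where

    ∈-─⁻ : ∀ {a t : A} L (m : a ∈ L) → t ∈ (L ─ m) → t ∈ L
    ∈-─⁻ (_ ∷ L) (here _)  n         = there n
    ∈-─⁻ (_ ∷ L) (there m) (here e)  = here e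
    ∈-─⁻ (_ ∷ L) (there m) (there n) = there (∈-─⁻ L m n)

    ∈-─⁺ : ∀ {a t : A} L (m : a ∈ L) → t ∈ L → t ≢ a → t ∈ (L ─ m)
    ∈-─⁺ (_ ∷ L) (here refl) (here refl) t≢a = ⊥-elim (t≢a refl)
    ∈-─⁺ (_ ∷ L) (here refl) (there n)   _   = n
    ∈-─⁺ (_ ∷ L) (there m)   (here e)    _   = here e
    ∈-─⁺ (_ ∷ L) (there m)   (there n)   t≢a = there (∈-─⁺ L m n t≢a)

    ∉-─ : ∀ {a : A} L (m : a ∈ L) → Unique L → a ∉ (L ─ m)
    ∉-─ (_ ∷ L) (here refl) u       n           = Unique[x∷xs]⇒x∉xs u n
    ∉-─ (_ ∷ L) (there m)   u       (here refl) = Unique[x∷xs]⇒x∉xs u m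
    ∉-─ (_ ∷ L) (there m)   (_ ∷ u) (there n)   = ∉-─ L m u n

    Unique-─ : ∀ {a : A} L (m : a ∈ L) → Unique L → Unique (L ─ m)
    Unique-─ (_ ∷ L) (here _)  (_ ∷ u)    = u
    Unique-─ (_ ∷ L) (there m) u@(_ ∷ u′) =
      All.tabulate (λ t∈ b≡t → Unique[x∷xs]⇒x∉xs u (subst (_∈ L) (sym b≡t) (∈-─⁻ L m t∈)))
      ∷ Unique-─ L m u′

    record IsInvolutionOn (f : A → A) (L : List A) : Set where
      field
        closed     : ∀ {t} → t ∈ L → f t ∈ L
        involutive : ∀ {t} → t ∈ L → f (f t) ≡ t
    open IsInvolutionOn

    remove-fixed : ∀ {f a L} (m : a ∈ L) → Unique L → IsInvolutionOn f L → f a ≡ a →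
                   IsInvolutionOn f (L ─ m)
    remove-fixed {f} {L = L} m u inv fa≡a = record
      { closed     = λ t∈ → let t∈L = ∈-─⁻ L m t∈ in
          ∈-─⁺ L m (closed inv t∈L) (λ ft≡a → ∉-─ L m u (subst (_∈ (L ─ m))
            (trans (sym (involutive inv t∈L)) (trans (cong f ft≡a) fa≡a)) t∈))
      ; involutive = λ t∈ → involutive inv (∈-─⁻ L m t∈)
      }

    remove-orbit : ∀ {f a L} (m : f a ∈ L) → Unique (a ∷ L) → IsInvolutionOn f (a ∷ L) →
                   IsInvolutionOn f (L ─ m)
    remove-orbit {f} {L = L} m u@(_ ∷ u′) inv = record
      { closed     = λ t∈ → let t∈L = ∈-─⁻ L m t∈ in
          ∈-─⁺ L m (ft∈L t∈L t∈) (λ ft≡fa → Unique[x∷xs]⇒x∉xs u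
            (subst (_∈ L) (trans (sym (involutive inv (there t∈L)))
                          (trans (cong f ft≡fa) (involutive inv (here refl)))) t∈L))
      ; involutive = λ t∈ → involutive inv (there (∈-─⁻ L m t∈))
      }
      where
      ft∈L : ∀ {t} → t ∈ L → t ∈ (L ─ m) → f t ∈ L
      ft∈L t∈L t∈ with closed inv (there t∈L)
      ... | there ft∈L = ft∈L
      ... | here ft≡a  = ⊥-elim (∉-─ L m u′ (subst (_∈ (L ─ m))
                          (trans (sym (involutive inv (there t∈L))) (cong f ft≡a)) t∈))

    -- The recursion removes one orbit
    -- {a , f a} at a time; the fuel n bounds the length.
    even-length : ∀ {f} n L → length L ≤ n → Unique L → IsInvolutionOn f L →
                  (∀ {t} → t ∈ L → f t ≢ t) → ∃[ k ] length L ≡ 2 * k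
    even-length _ [] _ _ _ _ = 0 , refl
    even-length (suc n) (a ∷ L) (s≤s len) u@(_ ∷ u′) inv fixFree with closed inv (here refl)
    ... | here fa≡a = ⊥-elim (fixFree (here refl) fa≡a)
    ... | there m with even-length n (L ─ m) shorter (Unique-─ L m u′) (remove-orbit m u inv)
                         (λ t∈ → fixFree (there (∈-─⁻ L m t∈)))
      where
      shorter : length (L ─ m) ≤ n
      shorter = ≤-trans (n≤1+n _) (subst (_≤ n) (length-removeAt′ L _) len)
    ... | k , eq = suc k , (begin
      suc (length L)             ≡⟨ cong suc (length-removeAt′ L _) ⟩
      suc (suc (length (L ─ m))) ≡⟨ cong (suc ∘ suc) eq ⟩
      suc (suc (2 * k))          ≡⟨ solve (k ∷ []) ⟩
      2 * suc k                  ∎)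

    odd-length : ∀ {f t₀} L → Unique L → IsInvolutionOn f L → t₀ ∈ L → f t₀ ≡ t₀ →
                 (∀ {t} → t ∈ L → f t ≡ t → t ≡ t₀) → ∃[ k ] length L ≡ suc (2 * k)
    odd-length L u inv m ft₀≡t₀ unique
      with even-length _ (L ─ m) ≤-refl (Unique-─ L m u) (remove-fixed m u inv ft₀≡t₀)
             (λ t∈ ft≡t → ∉-─ L m u (subst (_∈ (L ─ m)) (unique (∈-─⁻ L m t∈) ft≡t) t∈))
    ... | k , eq = k , trans (length-removeAt′ L _) (cong suc eq)

    fixed-point-by-parity : ∀ {f g t₀} L → Unique L → IsInvolutionOn f L → (∀ t → Dec (f t ≡ t)) →
      IsInvolutionOn g L → t₀ ∈ L → g t₀ ≡ t₀ → (∀ {t} → t ∈ L → g t ≡ t → t ≡ t₀) →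
      ∃[ t ] t ∈ L × f t ≡ t
    fixed-point-by-parity L u invf fixed? invg m gt₀≡t₀ unique with any? fixed? L
    ... | yes fixedPoint = find fixedPoint
    ... | no noFixedPoint with even-length _ L ≤-refl u invf (λ t∈ ft≡t → noFixedPoint (lose t∈ ft≡t))
                             | odd-length L u invg m gt₀≡t₀ unique
    ...   | k , even | j , odd = ⊥-elim (even≢odd k j (trans (sym even) odd))

-- Fermat's two-square theorem for primes p = 4n + 1, via Zagier's
-- involution of the windmill triples x² + 4yz = p.
module TwoSquares where

  open import Data.Nat
  open import Data.Nat.Properties
  open import Data.Nat.DivMod using (m≡m%n+[m/n]*n)
  open import Data.Nat.Divisibility using (divides)
  open import Data.Nat.Primality using (Prime; prime⇒irreducible; ¬prime[1]; prime⇒nonZero)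
  open import Data.Nat.Tactic.RingSolver using (solve; solve-∀)
  open import Data.Product using (_×_; _,_; ∃-syntax; proj₁; proj₂)
  open import Data.Product.Properties using (≡-dec)
  open import Data.Sum using (_⊎_; inj₁; inj₂; [_,_]′)
  open import Function using (id; _∘_)
  open import Data.Empty using (⊥-elim)
  open import Data.List using (List; []; _∷_; filter; upTo; cartesianProduct)
  open import Data.List.Membership.Propositional using (_∈_)
  open import Data.List.Membership.Propositional.Properties
    using (∈-filter⁺; ∈-filter⁻; ∈-cartesianProduct⁺; ∈-upTo⁺)
  open import Data.List.Relation.Unary.Unique.Propositional using (Unique)
  import Data.List.Relation.Unary.Unique.Propositional.Properties as Unique
  open import Relation.Nullary using (¬_; Dec; yes; no; contradiction)
  open import Relation.Nullary.Decidable using (map′)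
  open import Relation.Binary.Definitions using (tri<; tri≈; tri>)
  open import Relation.Binary.PropositionalEquality
  open ≡-Reasoning
  open InvolutionParity

  prime-unit-factor : ∀ {p} a b → Prime p → a * b ≡ p → a ≡ 1 ⊎ b ≡ 1
  prime-unit-factor {p} a b pr ab≡p with prime⇒irreducible pr (divides b (sym (trans (*-comm b a) ab≡p)))
  ... | inj₁ a≡1 = inj₁ a≡1
  ... | inj₂ a≡p = inj₂ (*-cancelˡ-≡ b 1 p {{prime⇒nonZero pr}} (begin
    p * b ≡⟨ cong (_* b) a≡p ⟨
    a * b ≡⟨ ab≡p ⟩
    p     ≡⟨ *-identityʳ p ⟨
    p * 1 ∎))

  prime-not-square : ∀ {p} x → Prime p → x * x ≢ p
  prime-not-square x pr x²≡p =
    ¬prime[1] (subst Prime (trans (sym x²≡p) (cong (λ y → y * y) x≡1)) pr)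
    where
    x≡1 : x ≡ 1
    x≡1 = [ id , id ]′ (prime-unit-factor x x pr x²≡p)

  <-witness : ∀ {a b} k → a + suc k ≡ b → a < b
  <-witness {a} k refl = m<m+n a z<s

  ∸-witness : ∀ {a b} k → a + k ≡ b → b ∸ a ≡ k
  ∸-witness {a} k refl = m+n∸m≡n a k

  Triple : Set
  Triple = ℕ × ℕ × ℕ

  data Windmill (p : ℕ) : Triple → Set where
    windmill : ∀ {x y z} → x * x + 4 * (y * z) ≡ p → Windmill p (x , y , z)

  zag : Triple → Triple
  zag (x , y , z) with x + z <? y | x <? 2 * y
  ... | yes _ | _     = (x + 2 * z , z , y ∸ (x + z))
  ... | no _  | yes _ = (2 * y ∸ x , y , x + z ∸ y)
  ... | no _  | no _  = (x ∸ 2 * y , x + z ∸ y , y)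

  -- The three regions on which zag is given by one formula, with the
  -- differences appearing in the formulas replaced by additive witnesses.
  data Region : Triple → Set where
    region₁ : ∀ x z k → Region (x , suc (x + z + k) , z)
    region₂ : ∀ {x y z} k m → y + suc k ≡ x + z → x + suc m ≡ 2 * y → Region (x , y , z)
    region₃ : ∀ y m z → Region (suc (2 * y + m) , y , z)

  zag-region₁ : ∀ x z k → zag (x , suc (x + z + k) , z) ≡ (x + 2 * z , z , suc k)
  zag-region₁ x z k with x + z <? suc (x + z + k)
  ... | yes _ = cong (λ c → (x + 2 * z , z , c)) (∸-witness (suc k) (+-suc (x + z) k))
  ... | no x+z≮y = contradiction (<-witness k (+-suc (x + z) k)) x+z≮y

  zag-region₂ : ∀ {x y z} k m → y + suc k ≡ x + z → x + suc m ≡ 2 * y →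
                zag (x , y , z) ≡ (suc m , y , suc k)
  zag-region₂ {x} {y} {z} k m h₁ h₂ with x + z <? y | x <? 2 * y
  ... | yes x+z<y | _       = contradiction x+z<y (<⇒≯ (<-witness k h₁))
  ... | no _      | no x≮2y = contradiction (<-witness m h₂) x≮2y
  ... | no _      | yes _   = cong₂ (λ a c → (a , y , c)) (∸-witness (suc m) h₂) (∸-witness (suc k) h₁)

  region₃-excess : ∀ y m z → y + suc (y + m + z) ≡ suc (2 * y + m) + z
  region₃-excess = solve-∀

  zag-region₃ : ∀ y m z → zag (suc (2 * y + m) , y , z) ≡ (suc m , suc (y + m + z) , y)
  zag-region₃ y m z with suc (2 * y + m) + z <? y | suc (2 * y + m) <? 2 * y
  ... | yes x+z<y | _        = contradiction x+z<y (<⇒≯ (<-witness {y} (y + m + z) (region₃-excess y m z)))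
  ... | no _      | yes x<2y = contradiction x<2y (<⇒≯ (<-witness m (+-suc (2 * y) m)))
  ... | no _      | no _     = cong₂ (λ a b → (a , b , y))
        (∸-witness (suc m) (+-suc (2 * y) m)) (∸-witness {y} (suc (y + m + z)) (region₃-excess y m z))

  module Windmills (n : ℕ) (prime : Prime (suc (4 * n))) where

    p : ℕ
    p = suc (4 * n)

    four∤p : ∀ a → 4 * a ≢ p
    four∤p a 4a≡p = even≢odd (2 * a) (2 * n) (begin
      2 * (2 * a)      ≡⟨ solve (a ∷ []) ⟩
      4 * a            ≡⟨ 4a≡p ⟩
      suc (4 * n)      ≡⟨ cong suc (solve (n ∷ [])) ⟩
      suc (2 * (2 * n)) ∎)

    x≢0 : ∀ {y z} → ¬ Windmill p (0 , y , z)
    x≢0 {y} {z} (windmill w) = four∤p (y * z) w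

    yz≢0 : ∀ {x y z} → Windmill p (x , y , z) → y * z ≢ 0
    yz≢0 {x} {y} {z} (windmill w) yz≡0 = prime-not-square x prime (begin
      x * x               ≡⟨ +-identityʳ (x * x) ⟨
      x * x + 4 * 0       ≡⟨ cong (λ c → x * x + 4 * c) yz≡0 ⟨
      x * x + 4 * (y * z) ≡⟨ w ⟩
      p                   ∎)

    not-on-boundary₁ : ∀ {x z} → ¬ Windmill p (x , x + z , z)
    not-on-boundary₁ {x} {z} (windmill w) = prime-not-square (x + 2 * z) prime (begin
      (x + 2 * z) * (x + 2 * z)   ≡⟨ solve (x ∷ z ∷ []) ⟩
      x * x + 4 * ((x + z) * z)   ≡⟨ w ⟩
      p                           ∎)

    not-on-boundary₂ : ∀ {y z} → ¬ Windmill p (2 * y , y , z)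
    not-on-boundary₂ {y} {z} (windmill w) = four∤p (y * (y + z)) (begin
      4 * (y * (y + z))             ≡⟨ solve (y ∷ z ∷ []) ⟩
      2 * y * (2 * y) + 4 * (y * z) ≡⟨ w ⟩
      p                             ∎)

    region : ∀ {t} → Windmill p t → Region t
    region {x , y , z} w with <-cmp (x + z) y
    ... | tri≈ _ refl _ = ⊥-elim (not-on-boundary₁ w)
    ... | tri< x+z<y _ _ with m≤n⇒∃[o]m+o≡n x+z<y
    ...   | k , refl = region₁ x z k
    region {x , y , z} w | tri> _ _ y<x+z with <-cmp x (2 * y)
    ... | tri≈ _ refl _ = ⊥-elim (not-on-boundary₂ w)
    ... | tri> _ _ 2y<x with m≤n⇒∃[o]m+o≡n 2y<x
    ...   | m , refl = region₃ y m z
    region {x , y , z} w | tri> _ _ y<x+z | tri< x<2y _ _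
      with m≤n⇒∃[o]m+o≡n y<x+z | m≤n⇒∃[o]m+o≡n x<2y
    ... | k , h₁ | m , h₂ = region₂ k m (trans (+-suc y k) h₁) (trans (+-suc x m) h₂)

    -- On the middle region the windmill equation is preserved because
    -- (2y - x)² + 4y(x + z - y) = x² + 4yz; in ℕ we add 2ax + x² to both sides
    -- so that only the additive relations a + x = 2y and y + b = x + z are used.
    region₂-identity : ∀ x y z a b → a + x ≡ 2 * y → y + b ≡ x + z →
                       a * a + 4 * (y * b) ≡ x * x + 4 * (y * z)
    region₂-identity x y z a b h₁ h₂ = +-cancelʳ-≡ (2 * (a * x) + x * x) _ _ (begin
      a * a + 4 * (y * b) + (2 * (a * x) + x * x) ≡⟨ solve (a ∷ x ∷ y ∷ b ∷ []) ⟩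
      (a + x) * (a + x) + 4 * (y * b)             ≡⟨ cong (λ s → s * s + 4 * (y * b)) h₁ ⟩
      2 * y * (2 * y) + 4 * (y * b)               ≡⟨ solve (y ∷ b ∷ []) ⟩
      4 * y * (y + b)                             ≡⟨ cong (4 * y *_) h₂ ⟩
      4 * y * (x + z)                             ≡⟨ solve (x ∷ y ∷ z ∷ []) ⟩
      2 * x * (2 * y) + 4 * (y * z)               ≡⟨ cong (λ s → 2 * x * s + 4 * (y * z)) h₁ ⟨
      2 * x * (a + x) + 4 * (y * z)               ≡⟨ solve (a ∷ x ∷ y ∷ z ∷ []) ⟩
      x * x + 4 * (y * z) + (2 * (a * x) + x * x) ∎)

    -- The middle region is mapped to itself: the sum of the second and third
    -- coordinates is unchanged.
    region₂-sum : ∀ x y z a b → x + a ≡ 2 * y → y + b ≡ x + z → y + z ≡ a + b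
    region₂-sum x y z a b h₁ h₂ = +-cancelʳ-≡ (x + y) _ _ (begin
      y + z + (x + y)   ≡⟨ solve (x ∷ y ∷ z ∷ []) ⟩
      2 * y + (x + z)   ≡⟨ cong₂ _+_ h₁ h₂ ⟨
      x + a + (y + b)   ≡⟨ solve (x ∷ y ∷ a ∷ b ∷ []) ⟩
      a + b + (x + y)   ∎)

    zag-windmill : ∀ {t} → Windmill p t → Windmill p (zag t)
    zag-windmill w = preserved (region w) w
      where
      region₁-identity : ∀ x z k → (x + 2 * z) * (x + 2 * z) + 4 * (z * suc k)
                                   ≡ x * x + 4 * (suc (x + z + k) * z)
      region₁-identity = solve-∀
      region₃-identity : ∀ y m z → suc m * suc m + 4 * (suc (y + m + z) * y)
                                   ≡ suc (2 * y + m) * suc (2 * y + m) + 4 * (y * z)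
      region₃-identity = solve-∀
      preserved : ∀ {t} → Region t → Windmill p t → Windmill p (zag t)
      preserved (region₁ x z k) (windmill w) rewrite zag-region₁ x z k =
        windmill (trans (region₁-identity x z k) w)
      preserved (region₂ {x} {y} {z} k m h₁ h₂) (windmill w) rewrite zag-region₂ k m h₁ h₂ =
        windmill (trans (region₂-identity x y z (suc m) (suc k) (trans (+-comm (suc m) x) h₂) h₁) w)
      preserved (region₃ y m z) (windmill w) rewrite zag-region₃ y m z =
        windmill (trans (region₃-identity y m z) w)

    -- zag is an involution: it exchanges the first and third regions and maps
    -- the middle region to itself.
    zag-involutive : ∀ {t} → Windmill p t → zag (zag t) ≡ t
    zag-involutive w = involutive (region w) w
      where
      involutive : ∀ {t} → Region t → Windmill p t → zag (zag t) ≡ t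
      involutive (region₁ zero z k) w = ⊥-elim (x≢0 w)
      involutive (region₁ (suc x) z k) w = begin
        zag (zag (suc x , suc (suc x + z + k) , z)) ≡⟨ cong zag (zag-region₁ (suc x) z k) ⟩
        zag (suc x + 2 * z , z , suc k)             ≡⟨ cong (λ a → zag (a , z , suc k)) (solve (x ∷ z ∷ [])) ⟩
        zag (suc (2 * z + x) , z , suc k)           ≡⟨ zag-region₃ z x (suc k) ⟩
        (suc x , suc (z + x + suc k) , z)           ≡⟨ cong (λ b → (suc x , b , z)) (solve (x ∷ z ∷ k ∷ [])) ⟩
        (suc x , suc (suc x + z + k) , z)           ∎
      involutive (region₃ y m zero) w = ⊥-elim (yz≢0 w (*-zeroʳ y))
      involutive (region₃ y m (suc k)) w = begin
        zag (zag (suc (2 * y + m) , y , suc k))     ≡⟨ cong zag (zag-region₃ y m (suc k)) ⟩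
        zag (suc m , suc (y + m + suc k) , y)       ≡⟨ cong (λ b → zag (suc m , b , y)) (solve (y ∷ m ∷ k ∷ [])) ⟩
        zag (suc m , suc (suc m + y + k) , y)       ≡⟨ zag-region₁ (suc m) y k ⟩
        (suc m + 2 * y , y , suc k)                 ≡⟨ cong (λ a → (a , y , suc k)) (solve (y ∷ m ∷ [])) ⟩
        (suc (2 * y + m) , y , suc k)               ∎
      involutive (region₂ {zero} k m h₁ h₂) w = ⊥-elim (x≢0 w)
      involutive (region₂ {suc x} {y} {zero} k m h₁ h₂) w = ⊥-elim (yz≢0 w (*-zeroʳ y))
      involutive (region₂ {suc x} {y} {suc z} k m h₁ h₂) w = begin
        zag (zag (suc x , y , suc z)) ≡⟨ cong zag (zag-region₂ k m h₁ h₂) ⟩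
        zag (suc m , y , suc k)       ≡⟨ zag-region₂ z x (region₂-sum (suc x) y (suc z) (suc m) (suc k) h₂ h₁)
                                                       (trans (+-comm (suc m) (suc x)) h₂) ⟩
        (suc x , y , suc z)           ∎

    -- The only fixed point of zag is (1 , 1 , n): fixed points lie in the
    -- middle region with x = y, and then x (x + 4z) = p forces x = 1.
    zag-fixed : ∀ {t} → Windmill p t → zag t ≡ t → t ≡ (1 , 1 , n)
    zag-fixed w = fixed (region w) w
      where
      a≢a+suc : ∀ a c → a ≢ a + suc c
      a≢a+suc a c e = m+1+n≰m a (≤-reflexive (sym e))

      double-injective : ∀ a b → a + a ≡ 2 * b → a ≡ b
      double-injective a b e = *-cancelˡ-≡ a b 2 (begin
        2 * a   ≡⟨ solve (a ∷ []) ⟩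
        a + a   ≡⟨ e ⟩
        2 * b   ∎)

      factor : ∀ m k → suc m * (suc m + 4 * suc k) ≡ suc m * suc m + 4 * (suc m * suc k)
      factor = solve-∀

      at-one : ∀ k → suc (4 * suc k) ≡ 1 * 1 + 4 * (1 * suc k)
      at-one = solve-∀

      fixed : ∀ {t} → Region t → Windmill p t → zag t ≡ t → t ≡ (1 , 1 , n)
      fixed (region₁ x z k) _ fix = ⊥-elim (a≢a+suc z (x + k) (begin
        z                 ≡⟨ cong (proj₁ ∘ proj₂) (trans (sym (zag-region₁ x z k)) fix) ⟩
        suc (x + z + k)   ≡⟨ solve (x ∷ z ∷ k ∷ []) ⟩
        z + suc (x + k)   ∎))
      fixed (region₃ y m z) _ fix = ⊥-elim (a≢a+suc y (m + z) (begin
        y                 ≡⟨ cong (proj₁ ∘ proj₂) (trans (sym (zag-region₃ y m z)) fix) ⟨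
        suc (y + m + z)   ≡⟨ solve (y ∷ m ∷ z ∷ []) ⟩
        y + suc (m + z)   ∎))
      fixed (region₂ {y = y} k m h₁ h₂) (windmill w) fix with trans (sym (zag-region₂ k m h₁ h₂)) fix
      ... | refl with double-injective (suc m) y h₂
      ...   | refl with prime-unit-factor (suc m) (suc m + 4 * suc k) prime (trans (factor m k) w)
      ...     | inj₂ x+4z≡1 = ⊥-elim (4z≢0 (m+n≡0⇒n≡0 m (suc-injective x+4z≡1)))
        where
        4z≢0 : 4 * suc k ≢ 0
        4z≢0 ()
      ...     | inj₁ refl = cong (λ c → (1 , 1 , c))
        (*-cancelˡ-≡ (suc k) n 4 (suc-injective (trans (at-one k) w)))

    -- (1 , 1 , n) is a windmill, and it is fixed by zag (n ≠ 0 as p is prime).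
    zag-fixes : zag (1 , 1 , n) ≡ (1 , 1 , n)
    zag-fixes = fixes n prime
      where
      fixes : ∀ m → Prime (suc (4 * m)) → zag (1 , 1 , m) ≡ (1 , 1 , m)
      fixes (suc k) _ = zag-region₂ {1} {1} {suc k} k 0 refl refl

    windmill-fixed : Windmill p (1 , 1 , n)
    windmill-fixed = windmill (cong (λ c → suc (4 * c)) (*-identityˡ n))

    -- All windmill triples of p, as a duplicate-free list: their coordinates
    -- are at most p.
    windmill? : ∀ t → Dec (Windmill p t)
    windmill? (x , y , z) = map′ windmill (λ { (windmill e) → e }) (x * x + 4 * (y * z) ≟ p)

    range : List ℕ
    range = upTo (suc p)

    windmills : List Triple
    windmills = filter windmill? (cartesianProduct range (cartesianProduct range range))

    windmills-unique : Unique windmills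
    windmills-unique = Unique.filter⁺ windmill?
      (Unique.cartesianProduct⁺ (Unique.upTo⁺ (suc p))
        (Unique.cartesianProduct⁺ (Unique.upTo⁺ (suc p)) (Unique.upTo⁺ (suc p))))

    windmills-sound : ∀ {t} → t ∈ windmills → Windmill p t
    windmills-sound m = proj₂ (∈-filter⁻ windmill? {xs = cartesianProduct range (cartesianProduct range range)} m)

    windmills-complete : ∀ {t} → Windmill p t → t ∈ windmills
    windmills-complete {x , y , z} w@(windmill e) = ∈-filter⁺ windmill?
      (∈-cartesianProduct⁺ (in-range x≤p) (∈-cartesianProduct⁺ (in-range y≤p) (in-range z≤p))) w
      where
      in-range : ∀ {a} → a ≤ p → a ∈ range
      in-range a≤p = ∈-upTo⁺ (s≤s a≤p)
      y≢0 : y ≢ 0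
      y≢0 refl = yz≢0 w refl
      z≢0 : z ≢ 0
      z≢0 refl = yz≢0 w (*-zeroʳ y)
      ≤-square : ∀ a → a ≤ a * a
      ≤-square zero    = z≤n
      ≤-square (suc a) = m≤m*n (suc a) (suc a)
      x≤p : x ≤ p
      x≤p = ≤-trans (≤-square x) (≤-trans (m≤m+n (x * x) _) (≤-reflexive e))
      yz≤p : y * z ≤ p
      yz≤p = ≤-trans (m≤n*m (y * z) 4) (≤-trans (m≤n+m _ (x * x)) (≤-reflexive e))
      y≤p : y ≤ p
      y≤p = ≤-trans (m≤m*n y z {{≢-nonZero z≢0}}) yz≤p
      z≤p : z ≤ p
      z≤p = ≤-trans (m≤n*m z y {{≢-nonZero y≢0}}) yz≤p

    zag-involution : IsInvolutionOn zag windmills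
    zag-involution = record
      { closed     = windmills-complete ∘ zag-windmill ∘ windmills-sound
      ; involutive = zag-involutive ∘ windmills-sound
      }

    swap : Triple → Triple
    swap (x , y , z) = (x , z , y)

    swap-involution : IsInvolutionOn swap windmills
    swap-involution = record
      { closed     = λ m → windmills-complete (swapped (windmills-sound m))
      ; involutive = λ _ → refl
      }
      where
      swapped : ∀ {t} → Windmill p t → Windmill p (swap t)
      swapped {x , y , z} (windmill e) = windmill (trans (cong (λ c → x * x + 4 * c) (*-comm z y)) e)

    -- Fermat's two-square theorem (Zagier's proof): zag has exactly one fixed
    -- point, so the number of windmills is odd and swap has a fixed point
    -- (x , y , y), giving p = x² + (2y)².
    two-squares : ∃[ a ] ∃[ b ] a * a + b * b ≡ p
    two-squares
      with fixed-point-by-parity windmills windmills-unique swap-involution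
             (λ t → ≡-dec _≟_ (≡-dec _≟_ _≟_) (swap t) t) zag-involution
             (windmills-complete windmill-fixed) zag-fixes (λ m → zag-fixed (windmills-sound m))
    ... | (x , y , z) , m , swap-fixed with windmills-sound m | cong (proj₁ ∘ proj₂) swap-fixed
    ...   | windmill e | refl = x , 2 * y , trans (cong (x * x +_) (four-squares y)) e
      where
      four-squares : ∀ y → 2 * y * (2 * y) ≡ 4 * (y * y)
      four-squares = solve-∀

  fermat-two-squares : ∀ {p} → Prime p → p % 4 ≡ 1 → ∃[ a ] ∃[ b ] a * a + b * b ≡ p
  fermat-two-squares {p} pr p%4≡1 = subst (λ q → ∃[ a ] ∃[ b ] a * a + b * b ≡ q) (sym p≡4n+1)
    (Windmills.two-squares (p / 4) (subst Prime p≡4n+1 pr))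
    where
    p≡4n+1 : p ≡ suc (4 * (p / 4))
    p≡4n+1 = trans (m≡m%n+[m/n]*n p 4) (cong₂ _+_ p%4≡1 (*-comm (p / 4) 4))

module GaussianIntegers where

  open import Data.Integer using (ℤ; +_; -_; _+_; _-_; _*_)
  open import Data.Integer.Properties using (neg-injective)
  open import Data.Integer.Tactic.RingSolver using (solve; solve-∀)
  open import Data.Product using (_×_; _,_; proj₁; proj₂)
  open import Data.List using (_∷_; [])
  open import Relation.Binary.PropositionalEquality

  𝔾 : Set
  𝔾 = ℤ × ℤ

  infixl 7 _·_
  infixr 7 _•_
  infixl 6 _⊕_

  _·_ : 𝔾 → 𝔾 → 𝔾
  (a , b) · (c , d) = (a * c - b * d , a * d + b * c)

  _⊕_ : 𝔾 → 𝔾 → 𝔾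
  (a , b) ⊕ (c , d) = (a + c , b + d)

  _•_ : ℤ → 𝔾 → 𝔾
  k • (a , b) = (k * a , k * b)

  1ᵍ : 𝔾
  1ᵍ = (+ 1 , + 0)

  conj : 𝔾 → 𝔾
  conj (a , b) = (a , - b)

  negate : 𝔾 → 𝔾
  negate (a , b) = (- a , - b)

  -- Multiplication by i: rotation by a quarter turn.
  rotate : 𝔾 → 𝔾
  rotate (a , b) = (- b , a)

  sq : 𝔾 → 𝔾
  sq z = z · z

  norm : 𝔾 → ℤ
  norm (a , b) = a * a + b * b

  cross : 𝔾 → 𝔾 → ℤ
  cross (a , b) (c , d) = a * d - b * c

  dot : 𝔾 → 𝔾 → ℤ
  dot (a , b) (c , d) = a * c + b * d

  ·-comm : ∀ u v → u · v ≡ v · u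
  ·-comm (a , b) (c , d) =
    cong₂ _,_ (solve (a ∷ b ∷ c ∷ d ∷ [])) (solve (a ∷ b ∷ c ∷ d ∷ []))

  ·-assoc : ∀ u v w → u · v · w ≡ u · (v · w)
  ·-assoc (a , b) (c , d) (e , f) = cong₂ _,_ (assoc-re a b c d e f) (assoc-im a b c d e f)
    where
    assoc-re : ∀ a b c d e f → (a * c - b * d) * e - (a * d + b * c) * f
                               ≡ a * (c * e - d * f) - b * (c * f + d * e)
    assoc-re = solve-∀
    assoc-im : ∀ a b c d e f → (a * c - b * d) * f + (a * d + b * c) * e
                               ≡ a * (c * f + d * e) + b * (c * e - d * f)
    assoc-im = solve-∀

  ·-identityˡ : ∀ u → 1ᵍ · u ≡ u
  ·-identityˡ (a , b) = cong₂ _,_ (unit-re a b) (unit-im a b)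
    where
    unit-re : ∀ a b → + 1 * a - + 0 * b ≡ a
    unit-re = solve-∀
    unit-im : ∀ a b → + 1 * b + + 0 * a ≡ b
    unit-im = solve-∀

  ·-negate : ∀ u v → u · negate v ≡ negate (u · v)
  ·-negate (a , b) (c , d) = cong₂ _,_ (re a b c d) (im a b c d)
    where
    re : ∀ a b c d → a * - c - b * - d ≡ - (a * c - b * d)
    re = solve-∀
    im : ∀ a b c d → a * - d + b * - c ≡ - (a * d + b * c)
    im = solve-∀

  conj-· : ∀ u v → conj (u · v) ≡ conj u · conj v
  conj-· (a , b) (c , d) = cong₂ _,_ (re a b c d) (im a b c d)
    where
    re : ∀ a b c d → a * c - b * d ≡ a * c - - b * - d
    re = solve-∀
    im : ∀ a b c d → - (a * d + b * c) ≡ a * - d + - b * c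
    im = solve-∀

  negate-injective : ∀ {u v} → negate u ≡ negate v → u ≡ v
  negate-injective {a , b} {c , d} e =
    cong₂ _,_ (neg-injective (cong proj₁ e)) (neg-injective (cong proj₂ e))

  sq-rotate : ∀ u → sq (rotate u) ≡ negate (sq u)
  sq-rotate (a , b) = cong₂ _,_ (re a b) (im a b)
    where
    re : ∀ a b → - b * - b - a * a ≡ - (a * a - b * b)
    re = solve-∀
    im : ∀ a b → - b * a + a * - b ≡ - (a * b + b * a)
    im = solve-∀

  norm-· : ∀ u v → norm (u · v) ≡ norm u * norm v
  norm-· (a , b) (c , d) = identity a b c d
    where
    identity : ∀ a b c d → (a * c - b * d) * (a * c - b * d) + (a * d + b * c) * (a * d + b * c)
                           ≡ (a * a + b * b) * (c * c + d * d)
    identity = solve-∀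

  norm-conj : ∀ u → norm (conj u) ≡ norm u
  norm-conj (a , b) = identity a b
    where
    identity : ∀ a b → a * a + - b * - b ≡ a * a + b * b
    identity = solve-∀

  norm-rotate : ∀ u → norm (rotate u) ≡ norm u
  norm-rotate (a , b) = identity a b
    where
    identity : ∀ a b → - b * - b + a * a ≡ a * a + b * b
    identity = solve-∀

  ·-conj : ∀ u w → u · w · conj w ≡ norm w • u
  ·-conj (a , b) (c , d) = cong₂ _,_ (re a b c d) (im a b c d)
    where
    re : ∀ a b c d → (a * c - b * d) * c - (a * d + b * c) * - d ≡ (c * c + d * d) * a
    re = solve-∀
    im : ∀ a b c d → (a * c - b * d) * - d + (a * d + b * c) * c ≡ (c * c + d * d) * b
    im = solve-∀

  -- A Gaussian integer π = a + bi satisfies π² + N(π) = 2a π, hence for all z: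
  -- z π π ⊕ N(π) z = 2a (z π).
  ·-twice : ∀ z a b → z · (a , b) · (a , b) ⊕ norm (a , b) • z ≡ (+ 2 * a) • (z · (a , b))
  ·-twice (x , y) a b = cong₂ _,_ (re x y a b) (im x y a b)
    where
    re : ∀ x y a b → (x * a - y * b) * a - (x * b + y * a) * b + (a * a + b * b) * x
                     ≡ + 2 * a * (x * a - y * b)
    re = solve-∀
    im : ∀ x y a b → (x * a - y * b) * b + (x * b + y * a) * a + (a * a + b * b) * y
                     ≡ + 2 * a * (x * b + y * a)
    im = solve-∀

  lagrange : ∀ u v → norm u * norm v ≡ cross u v * cross u v + dot u v * dot u v
  lagrange (a , b) (c , d) = identity a b c d
    where
    identity : ∀ a b c d → (a * a + b * b) * (c * c + d * d)
                           ≡ (a * d - b * c) * (a * d - b * c) + (a * c + b * d) * (a * c + b * d)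
    identity = solve-∀

  cross-rotate : ∀ u v → cross u (rotate v) ≡ dot u v
  cross-rotate (a , b) (c , d) = identity a b c d
    where
    identity : ∀ a b c d → a * c - b * - d ≡ a * c + b * d
    identity = solve-∀

  sq-· : ∀ u v → sq u · sq v ≡ sq (u · v)
  sq-· (a , b) (c , d) = cong₂ _,_ (re a b c d) (im a b c d)
    where
    re : ∀ a b c d → (a * a - b * b) * (c * c - d * d) - (a * b + b * a) * (c * d + d * c)
                     ≡ (a * c - b * d) * (a * c - b * d) - (a * d + b * c) * (a * d + b * c)
    re = solve-∀
    im : ∀ a b c d → (a * a - b * b) * (c * d + d * c) + (a * b + b * a) * (c * c - d * d)
                     ≡ (a * c - b * d) * (a * d + b * c) + (a * d + b * c) * (a * c - b * d)
    im = solve-∀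

  sq-• : ∀ k u → sq (k • u) ≡ (k * k) • sq u
  sq-• k (a , b) = cong₂ _,_ (re k a b) (im k a b)
    where
    re : ∀ k a b → k * a * (k * a) - k * b * (k * b) ≡ k * k * (a * a - b * b)
    re = solve-∀
    im : ∀ k a b → k * a * (k * b) + k * b * (k * a) ≡ k * k * (a * b + b * a)
    im = solve-∀

  conj-pair : ∀ g h → conj (g · h) · (g · conj h) ≡ norm g • sq (conj h)
  conj-pair (a , b) (c , d) = cong₂ _,_ (re a b c d) (im a b c d)
    where
    re : ∀ a b c d → (a * c - b * d) * (a * c - b * - d) - - (a * d + b * c) * (a * - d + b * c)
                     ≡ (a * a + b * b) * (c * c - - d * - d)
    re = solve-∀
    im : ∀ a b c d → (a * c - b * d) * (a * - d + b * c) + - (a * d + b * c) * (a * c - b * - d)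
                     ≡ (a * a + b * b) * (c * - d + - d * c)
    im = solve-∀

module SquarePoints where

  open import Data.Nat as ℕ using (ℕ)
  import Data.Nat.Properties as ℕ
  open import Data.Integer using (+_; -[1+_]; -_; _+_; _-_; _*_; ∣_∣)
  open import Data.Integer.Properties
    using (pos-*; pos-+; +-injective; ∣i∣≡0⇒i≡0; i-j≡0⇒i≡j; i*j≡0⇒i≡0∨j≡0; i≡j⇒i-j≡0)
  open import Data.Integer.Tactic.RingSolver using (solve-∀)
  open import Data.Nat.Tactic.RingSolver using () renaming (solve-∀ to ℕ-solve-∀)
  open import Data.Product using (_×_; _,_; proj₁; proj₂; ∃-syntax)
  open import Data.Sum using (_⊎_; inj₁; inj₂; [_,_]′)
  open import Function using (id)
  open import Relation.Binary.PropositionalEquality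
  open ≡-Reasoning
  open import Defs using (Point; dist²; HasDist; Collinear)
  open GaussianIntegers

  _⊖_ : 𝔾 → 𝔾 → 𝔾
  (a , b) ⊖ (c , d) = (a - c , b - d)

  origin : Point
  origin = (+ 0 , + 0)

  dist²-sym : ∀ P Q → dist² P Q ≡ dist² Q P
  dist²-sym (a , b) (c , d) = cong ∣_∣ (identity a b c d)
    where
    identity : ∀ a b c d → (a - c) * (a - c) + (b - d) * (b - d) ≡ (c - a) * (c - a) + (d - b) * (d - b)
    identity = solve-∀

  -- Note that dist² P Q is |N(P ⊖ Q)| by definition.

  four-squares : ∀ k → (2 ℕ.* k) ℕ.* (2 ℕ.* k) ≡ 4 ℕ.* (k ℕ.* k)
  four-squares = ℕ-solve-∀

  square-abs : ∀ i → i * i ≡ + (∣ i ∣ ℕ.* ∣ i ∣)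
  square-abs (+ n)    = sym (pos-* n n)
  square-abs -[1+ n ] = refl

  norm-abs : ∀ u → norm u ≡ + (∣ proj₁ u ∣ ℕ.* ∣ proj₁ u ∣ ℕ.+ ∣ proj₂ u ∣ ℕ.* ∣ proj₂ u ∣)
  norm-abs (a , b) = trans (cong₂ _+_ (square-abs a) (square-abs b)) (sym (pos-+ (∣ a ∣ ℕ.* ∣ a ∣) (∣ b ∣ ℕ.* ∣ b ∣)))

  norm-zero : ∀ u → norm u ≡ + 0 → u ≡ (+ 0 , + 0)
  norm-zero (a , b) n≡0 = cong₂ _,_ (zero-square a (ℕ.m+n≡0⇒m≡0 _ sum≡0)) (zero-square b (ℕ.m+n≡0⇒n≡0 _ sum≡0))
    where
    sum≡0 : ∣ a ∣ ℕ.* ∣ a ∣ ℕ.+ ∣ b ∣ ℕ.* ∣ b ∣ ≡ 0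
    sum≡0 = +-injective (trans (sym (norm-abs (a , b))) n≡0)
    zero-square : ∀ i → ∣ i ∣ ℕ.* ∣ i ∣ ≡ 0 → i ≡ + 0
    zero-square i e with ℕ.m*n≡0⇒m≡0∨n≡0 ∣ i ∣ e
    ... | inj₁ e′ = ∣i∣≡0⇒i≡0 e′
    ... | inj₂ e′ = ∣i∣≡0⇒i≡0 e′

  -- For Gaussian integers β, γ of equal norm, the squared distance between
  -- β² and γ² is 4 cross(β, γ)²: expand |β² - γ²|² and use Lagrange.
  squares-identity : ∀ β γ → norm (sq β ⊖ sq γ)
    ≡ norm β * norm β + norm γ * norm γ + + 4 * (cross β γ * cross β γ) - + 2 * (norm β * norm γ)
  squares-identity (a , b) (c , d) = identity a b c d
    where
    identity : ∀ a b c d →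
      ((a * a - b * b) - (c * c - d * d)) * ((a * a - b * b) - (c * c - d * d))
        + ((a * b + b * a) - (c * d + d * c)) * ((a * b + b * a) - (c * d + d * c))
      ≡ (a * a + b * b) * (a * a + b * b) + (c * c + d * d) * (c * c + d * d)
        + + 4 * ((a * d - b * c) * (a * d - b * c)) - + 2 * ((a * a + b * b) * (c * c + d * d))
    identity = solve-∀

  squares-distance : ∀ β γ → norm β ≡ norm γ → norm (sq β ⊖ sq γ) ≡ + 4 * (cross β γ * cross β γ)
  squares-distance β γ n≡m = begin
    norm (sq β ⊖ sq γ)                              ≡⟨ squares-identity β γ ⟩
    n * n + m * m + + 4 * (c * c) - + 2 * (n * m)   ≡⟨ cong (λ k → n * n + k * k + + 4 * (c * c) - + 2 * (n * k)) n≡m ⟨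
    n * n + n * n + + 4 * (c * c) - + 2 * (n * n)   ≡⟨ cancel n c ⟩
    + 4 * (c * c)                                   ∎
    where
    n = norm β
    m = norm γ
    c = cross β γ
    cancel : ∀ n c → n * n + n * n + + 4 * (c * c) - + 2 * (n * n) ≡ + 4 * (c * c)
    cancel = solve-∀

  squares-equal : ∀ β γ → norm β ≡ norm γ → cross β γ ≡ + 0 → sq β ≡ sq γ
  squares-equal β γ n≡m c≡0 = cong₂ _,_
    (i-j≡0⇒i≡j (proj₁ (sq β)) (proj₁ (sq γ)) (cong proj₁ difference≡0))
    (i-j≡0⇒i≡j (proj₂ (sq β)) (proj₂ (sq γ)) (cong proj₂ difference≡0))
    where
    difference≡0 : sq β ⊖ sq γ ≡ (+ 0 , + 0)
    difference≡0 = norm-zero (sq β ⊖ sq γ)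
      (trans (squares-distance β γ n≡m) (cong (λ c → + 4 * (c * c)) c≡0))

  collinear-identity : ∀ β γ → (proj₁ (sq β) - + 0) * (proj₂ (sq γ) - + 0)
                               - (proj₁ (sq γ) - + 0) * (proj₂ (sq β) - + 0)
                               ≡ + 2 * (dot β γ * cross β γ)
  collinear-identity (a , b) (c , d) = identity a b c d
    where
    identity : ∀ a b c d → ((a * a - b * b) - + 0) * ((c * d + d * c) - + 0)
                           - ((c * c - d * d) - + 0) * ((a * b + b * a) - + 0)
                           ≡ + 2 * ((a * c + b * d) * (a * d - b * c))
    identity = solve-∀

  collinear-area : ∀ β γ → Collinear origin (sq β) (sq γ) → + 2 * (dot β γ * cross β γ) ≡ + 0
  collinear-area β γ col = trans (sym (collinear-identity β γ)) (i≡j⇒i-j≡0 col)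

  -- If 0, β², γ² are collinear and N(β) = N(γ) then β² = ±γ²: either the
  -- cross term vanishes, or the dot term does, which is the cross term of β
  -- and iγ.
  collinear-squares : ∀ β γ → norm β ≡ norm γ → Collinear origin (sq β) (sq γ) →
                      sq β ≡ sq γ ⊎ sq β ≡ negate (sq γ)
  collinear-squares β γ n≡m col = from-area (i*j≡0⇒i≡0∨j≡0 (+ 2) (collinear-area β γ col))
    where
    from-factors : dot β γ ≡ + 0 ⊎ cross β γ ≡ + 0 → sq β ≡ sq γ ⊎ sq β ≡ negate (sq γ)
    from-factors (inj₂ c≡0) = inj₁ (squares-equal β γ n≡m c≡0)
    from-factors (inj₁ d≡0) = inj₂ (trans
      (squares-equal β (rotate γ) (trans n≡m (sym (norm-rotate γ))) (trans (cross-rotate β γ) d≡0))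
      (sq-rotate γ))
    from-area : + 2 ≡ + 0 ⊎ dot β γ * cross β γ ≡ + 0 → sq β ≡ sq γ ⊎ sq β ≡ negate (sq γ)
    from-area (inj₁ ())
    from-area (inj₂ dc≡0) = from-factors (i*j≡0⇒i≡0∨j≡0 (dot β γ) dc≡0)

  SquareOnCircle : ℕ → Point → Set
  SquareOnCircle R P = ∃[ β ] P ≡ sq β × norm β ≡ + R

  module Circle {R : ℕ} where

    norm-sq : ∀ β → norm β ≡ + R → norm (sq β) ≡ + (R ℕ.* R)
    norm-sq β n≡R = trans (norm-· β β) (trans (cong₂ _*_ n≡R n≡R) (sym (pos-* R R)))

    from-origin : ∀ {P} → SquareOnCircle R P → HasDist P origin R
    from-origin (β@(_ , _) , refl , n≡R) = sym (cong ∣_∣ (begin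
      norm (sq β ⊖ origin) ≡⟨ identity (proj₁ (sq β)) (proj₂ (sq β)) ⟩
      norm (sq β)          ≡⟨ norm-sq β n≡R ⟩
      + (R ℕ.* R)          ∎))
      where
      identity : ∀ x y → (x - + 0) * (x - + 0) + (y - + 0) * (y - + 0) ≡ x * x + y * y
      identity = solve-∀

    to-origin : ∀ {P} → SquareOnCircle R P → HasDist origin P R
    to-origin {P} on = trans (from-origin on) (dist²-sym P origin)

    -- Two such squares are at the even distance 2 |cross β γ|, which is at
    -- most the diameter 2R since cross² ≤ N(β) N(γ) by Lagrange's identity.
    between : ∀ β γ → norm β ≡ + R → norm γ ≡ + R → HasDist (sq β) (sq γ) (2 ℕ.* ∣ cross β γ ∣)
    between β γ nβ≡R nγ≡R = begin
      (2 ℕ.* k) ℕ.* (2 ℕ.* k)   ≡⟨ four-squares k ⟩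
      4 ℕ.* (k ℕ.* k)           ≡⟨ cong ∣_∣ (trans (cong (+ 4 *_) (square-abs c)) (sym (pos-* 4 (k ℕ.* k)))) ⟨
      ∣ + 4 * (c * c) ∣         ≡⟨ cong ∣_∣ (squares-distance β γ (trans nβ≡R (sym nγ≡R))) ⟨
      ∣ norm (sq β ⊖ sq γ) ∣    ∎
      where
      c = cross β γ
      k = ∣ c ∣

    cross-bound : ∀ β γ → norm β ≡ + R → norm γ ≡ + R → ∣ cross β γ ∣ ℕ.* ∣ cross β γ ∣ ℕ.≤ R ℕ.* R
    cross-bound β γ nβ≡R nγ≡R = ℕ.≤-trans (ℕ.m≤m+n _ (∣ d ∣ ℕ.* ∣ d ∣)) (ℕ.≤-reflexive (+-injective (begin
      + (∣ c ∣ ℕ.* ∣ c ∣ ℕ.+ ∣ d ∣ ℕ.* ∣ d ∣) ≡⟨ norm-abs (c , d) ⟨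
      c * c + d * d                         ≡⟨ lagrange β γ ⟨
      norm β * norm γ                       ≡⟨ cong₂ _*_ nβ≡R nγ≡R ⟩
      + R * + R                             ≡⟨ pos-* R R ⟨
      + (R ℕ.* R)                           ∎)))
      where
      c = cross β γ
      d = dot β γ

    sq≢origin : ∀ β → R ≢ 0 → norm β ≡ + R → sq β ≢ origin
    sq≢origin β R≢0 n≡R sq≡0 = R≢0 ([ id , id ]′ (ℕ.m*n≡0⇒m≡0∨n≡0 R R²≡0))
      where
      R²≡0 : R ℕ.* R ≡ 0
      R²≡0 = +-injective (trans (sym (norm-sq β n≡R)) (cong norm sq≡0))

    sq≢negate : ∀ β → R ≢ 0 → norm β ≡ + R → sq β ≢ negate (sq β)
    sq≢negate β R≢0 n≡R eq = sq≢origin β R≢0 n≡R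
      (cong₂ _,_ (self-negate (cong proj₁ eq)) (self-negate (cong proj₂ eq)))
      where
      self-negate : ∀ {x} → x ≡ - x → x ≡ + 0
      self-negate {+ 0} _ = refl

module Configuration where

  open import Data.Nat as ℕ using (ℕ; suc; _*_; _≤_; z≤n)
  import Data.Nat.Properties as ℕ
  open import Data.Nat.Tactic.RingSolver using (solve-∀)
  open import Data.Integer as ℤ using (+_; ∣_∣)
  open import Data.Product using (_×_; _,_; ∃-syntax)
  open import Data.Sum using (_⊎_; inj₁; inj₂)
  open import Data.List using (List; []; _∷_; length)
  open import Data.List.Membership.Propositional using (_∈_)
  open import Data.List.Relation.Unary.Any using (here; there)
  open import Data.List.Relation.Unary.All as All using (All; _∷_)
  open import Data.List.Relation.Unary.AllPairs using ([]; _∷_)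
  open import Data.List.Relation.Unary.Unique.Propositional using (Unique)
  open import Relation.Nullary using (¬_)
  open import Function using (_∘_; id)
  open import Relation.Binary.PropositionalEquality
  open import Defs
  open GaussianIntegers
  open SquarePoints
  open Circle

  CircleConfiguration : ℕ → ℕ → Set
  CircleConfiguration R n = ∃[ c ] ∃[ pts ]
    ( length pts ≡ 2 * n
    × (∀ {P} → P ∈ pts → HasDist P c R)
    × IsIntegralPointSet (c ∷ pts)
    × (∀ {P Q} → P ∈ pts → Q ∈ pts → ∃[ k ] HasDist P Q (2 * k))
    × HasDiameter (c ∷ pts) (2 * R) )

  module FromSquares
    (R : ℕ) (R≢0 : R ≢ 0) {Label : Set} (labels : List Label) (labels-unique : Unique labels)
    (β : Label → 𝔾) (norm-β : ∀ {d} → d ∈ labels → norm (β d) ≡ + R)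
    (separated : ∀ {d e} → d ∈ labels → e ∈ labels →
                 sq (β d) ≡ sq (β e) ⊎ sq (β d) ≡ negate (sq (β e)) → d ≡ e)
    {d₁ d₂ : Label} (d₁∈ : d₁ ∈ labels) (d₂∈ : d₂ ∈ labels) (d₁≢d₂ : d₁ ≢ d₂)
    where

    -- β_d² and (i β_d)² = -β_d² for every label d.
    squares : List Label → List Point
    squares []       = []
    squares (d ∷ ds) = sq (β d) ∷ sq (rotate (β d)) ∷ squares ds

    length-squares : ∀ ds → length (squares ds) ≡ 2 * length ds
    length-squares []       = refl
    length-squares (d ∷ ds) = trans (cong (suc ∘ suc) (length-squares ds)) (double-suc (length ds))
      where
      double-suc : ∀ n → suc (suc (2 * n)) ≡ 2 * suc n
      double-suc = solve-∀

    ∈-squares : ∀ {P} ds → P ∈ squares ds →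
                ∃[ d ] d ∈ ds × (P ≡ sq (β d) ⊎ P ≡ sq (rotate (β d)))
    ∈-squares (d ∷ ds) (here e)         = d , here refl , inj₁ e
    ∈-squares (d ∷ ds) (there (here e)) = d , here refl , inj₂ e
    ∈-squares (d ∷ ds) (there (there m)) with ∈-squares ds m
    ... | d′ , d′∈ , eq = d′ , there d′∈ , eq

    on-circle : ∀ {P} → P ∈ squares labels → SquareOnCircle R P
    on-circle m with ∈-squares labels m
    ... | d , d∈ , inj₁ refl = β d , refl , norm-β d∈
    ... | d , d∈ , inj₂ refl = rotate (β d) , refl , trans (norm-rotate (β d)) (norm-β d∈)

    SignedSquare : Label → Point → Set
    SignedSquare d P = P ≡ sq (β d) ⊎ P ≡ sq (rotate (β d))

    same-label : ∀ {d e P} → d ∈ labels → e ∈ labels → SignedSquare d P → SignedSquare e P → d ≡ e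
    same-label d∈ e∈ (inj₁ refl) (inj₁ eq) = separated d∈ e∈ (inj₁ eq)
    same-label {e = e} d∈ e∈ (inj₁ refl) (inj₂ eq) =
      separated d∈ e∈ (inj₂ (trans eq (sq-rotate (β e))))
    same-label {d} d∈ e∈ (inj₂ refl) (inj₁ eq) =
      sym (separated e∈ d∈ (inj₂ (trans (sym eq) (sq-rotate (β d)))))
    same-label {d} {e} d∈ e∈ (inj₂ refl) (inj₂ eq) =
      separated d∈ e∈ (inj₁ (negate-injective (trans (sym (sq-rotate (β d))) (trans eq (sq-rotate (β e))))))

    -- Hence the points are distinct (β² ≠ -β² as R ≠ 0).
    unique-squares : ∀ ds → (∀ {d} → d ∈ ds → d ∈ labels) → Unique ds → Unique (squares ds)
    unique-squares [] _ _ = []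
    unique-squares (d ∷ ds) sub (d∉ds ∷ u) =
      (sq≢-sq ∷ All.tabulate (fresh (inj₁ refl))) ∷ All.tabulate (fresh (inj₂ refl))
      ∷ unique-squares ds (sub ∘ there) u
      where
      fresh : ∀ {P Q} → SignedSquare d P → Q ∈ squares ds → P ≢ Q
      fresh sP Q∈ refl with ∈-squares ds Q∈
      ... | e , e∈ , sQ = All.lookup d∉ds e∈ (same-label (sub (here refl)) (sub (there e∈)) sP sQ)
      sq≢-sq : sq (β d) ≢ sq (rotate (β d))
      sq≢-sq eq = sq≢negate (β d) R≢0 (norm-β (sub (here refl))) (trans eq (sq-rotate (β d)))

    points : List Point
    points = squares labels

    D² : ℕ
    D² = (2 * R) * (2 * R)

    sq∈ : ∀ {d} ds → d ∈ ds → sq (β d) ∈ squares ds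
    sq∈ (_ ∷ ds) (here refl) = here refl
    sq∈ (_ ∷ ds) (there d∈)  = there (there (sq∈ ds d∈))

    rotated∈ : ∀ {d} ds → d ∈ ds → sq (rotate (β d)) ∈ squares ds
    rotated∈ (_ ∷ ds) (here refl) = there (here refl)
    rotated∈ (_ ∷ ds) (there d∈)  = there (there (rotated∈ ds d∈))

    even-distance : ∀ {P Q} → P ∈ points → Q ∈ points →
                    ∃[ k ] HasDist P Q (2 * k) × k * k ≤ R * R
    even-distance P∈ Q∈ with on-circle P∈ | on-circle Q∈
    ... | u , refl , nu | v , refl , nv = ∣ cross u v ∣ , between u v nu nv , cross-bound u v nu nv

    four-times : ∀ {a} → a ≤ R * R → 4 * a ≤ D²
    four-times a≤R² = ℕ.≤-trans (ℕ.*-monoʳ-≤ 4 a≤R²) (ℕ.≤-reflexive (sym (four-squares R)))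

    centre-bound : R * R ≤ D²
    centre-bound = ℕ.≤-trans (ℕ.m≤n*m (R * R) 4) (four-times ℕ.≤-refl)

    integral : ∀ {P Q} → P ∈ origin ∷ points → Q ∈ origin ∷ points → ∃[ d ] HasDist P Q d
    integral (here refl) (here refl) = 0 , refl
    integral (here refl) (there Q∈)  = R , to-origin (on-circle Q∈)
    integral (there P∈)  (here refl) = R , from-origin (on-circle P∈)
    integral (there P∈)  (there Q∈)  with even-distance P∈ Q∈
    ... | k , dist , _ = 2 * k , dist

    bounded : ∀ {P Q} → P ∈ origin ∷ points → Q ∈ origin ∷ points → dist² P Q ≤ D²
    bounded (here refl) (here refl) = z≤n
    bounded (here refl) (there Q∈)  = subst (_≤ D²) (to-origin (on-circle Q∈)) centre-bound
    bounded (there P∈)  (here refl) = subst (_≤ D²) (from-origin (on-circle P∈)) centre-bound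
    bounded (there P∈)  (there Q∈)  with even-distance P∈ Q∈
    ... | k , dist , k≤R = subst (_≤ D²) dist (subst (_≤ D²) (sym (four-squares k)) (four-times k≤R))

    diameter : ∃[ P ] ∃[ Q ] (P ∈ origin ∷ points × Q ∈ origin ∷ points × HasDist P Q (2 * R))
    diameter = sq (β d₁) , sq (rotate (β d₁)) , there (sq∈ labels d₁∈) , there (rotated∈ labels d₁∈) ,
      subst (λ k → HasDist (sq (β d₁)) (sq (rotate (β d₁))) (2 * k)) |cross|≡R
        (between (β d₁) (rotate (β d₁)) (norm-β d₁∈) (trans (norm-rotate (β d₁)) (norm-β d₁∈)))
      where
      |cross|≡R : ∣ cross (β d₁) (rotate (β d₁)) ∣ ≡ R
      |cross|≡R = cong ∣_∣ (trans (cross-rotate (β d₁) (β d₁)) (norm-β d₁∈))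

    not-collinear : ¬ Collinear origin (sq (β d₁)) (sq (β d₂))
    not-collinear col = d₁≢d₂ (separated d₁∈ d₂∈
      (collinear-squares (β d₁) (β d₂) (trans (norm-β d₁∈) (sym (norm-β d₂∈))) col))

    configuration : CircleConfiguration R (length labels)
    configuration = origin , points , length-squares labels , from-origin ∘ on-circle ,
      ( origin∉ ∷ unique-squares labels id labels-unique
      , ( origin , sq (β d₁) , sq (β d₂) , here refl , there (sq∈ labels d₁∈) , there (sq∈ labels d₂∈)
        , not-collinear )
      , integral ) ,
      (λ P∈ Q∈ → let k , dist , _ = even-distance P∈ Q∈ in k , dist) ,
      bounded , diameter
      where
      origin∉ : All (origin ≢_) points
      origin∉ = All.tabulate λ P∈ origin≡P → off-centre (on-circle P∈) (sym origin≡P)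
        where
        off-centre : ∀ {P} → SquareOnCircle R P → P ≢ origin
        off-centre (u , refl , nu) = sq≢origin u R≢0 nu

module Primitivity where

  open import Data.Nat as ℕ using (ℕ; zero; suc; _%_; _<_)
  import Data.Nat.Properties as ℕ
  import Data.Nat.Divisibility as ℕ
  open import Data.Nat.GCD using (gcd; c*gcd[m,n]≡gcd[cm,cn])
  open import Data.Nat.Coprimality using (Coprime; coprime⇒gcd≡1)
  open import Data.Nat.Primality
    using (Prime; ¬prime[1]; euclidsLemma; prime⇒irreducible; prime⇒nonZero; prime⇒nonTrivial; productOfPrimes≥1)
  open import Data.Nat.Primality.Factorisation
    using (factorise; factorisationHasAllPrimeFactors)
  open import Data.Nat.ListAction using (product)
  open import Data.Nat.ListAction.Properties using (∈⇒∣product)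
  open import Data.Integer using (+_; _+_; _*_; ∣_∣)
  open import Data.Integer.Properties using (abs-*; ∣-i∣≡∣i∣; pos-*; pos-+; +-injective; ∣i∣≡0⇒i≡0)
  open import Data.Integer.Divisibility.Signed
    using (_∣_; ∣ᵤ⇒∣; ∣⇒∣ᵤ; ∣m∣n⇒∣m+n; ∣m∣n⇒∣m-n; ∣m⇒∣m*n; ∣-refl)
  open import Data.Product using (_×_; _,_; proj₁; proj₂; ∃-syntax)
  open import Data.Sum using (_⊎_; inj₁; inj₂)
  open import Data.Empty using (⊥; ⊥-elim)
  open import Data.List using (List; []; _∷_; _++_)
  open import Data.List.Relation.Unary.All as All using (All; []; _∷_)
  open import Data.List.Relation.Unary.Any using (here)
  open import Data.List.Relation.Binary.Permutation.Propositional as ↭ using (_↭_)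
  open import Relation.Nullary using (¬_; yes; no)
  open import Relation.Binary.PropositionalEquality
  open GaussianIntegers
  open TwoSquares using (prime-not-square)

  _∣ᵍ_ : ℕ → 𝔾 → Set
  r ∣ᵍ (a , b) = (+ r ∣ a) × (+ r ∣ b)

  ∣ᵍ-· : ∀ {r} u w → r ∣ᵍ u → r ∣ᵍ (u · w)
  ∣ᵍ-· (a , b) (c , d) (r∣a , r∣b) =
    ∣m∣n⇒∣m-n (∣m⇒∣m*n c r∣a) (∣m⇒∣m*n d r∣b) , ∣m∣n⇒∣m+n (∣m⇒∣m*n d r∣a) (∣m⇒∣m*n c r∣b)

  ∣ᵍ-• : ∀ {r} k u → + r ∣ k → r ∣ᵍ (k • u)
  ∣ᵍ-• k (a , b) r∣k = ∣m⇒∣m*n a r∣k , ∣m⇒∣m*n b r∣k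

  ∣ᵍ-⊕ : ∀ {r} u v → r ∣ᵍ u → r ∣ᵍ v → r ∣ᵍ (u ⊕ v)
  ∣ᵍ-⊕ (a , b) (c , d) (r∣a , r∣b) (r∣c , r∣d) = ∣m∣n⇒∣m+n r∣a r∣c , ∣m∣n⇒∣m+n r∣b r∣d

  euclid : ∀ {r} i j → Prime r → + r ∣ i * j → (+ r ∣ i) ⊎ (+ r ∣ j)
  euclid {r} i j pr r∣ij with euclidsLemma ∣ i ∣ ∣ j ∣ pr (subst (r ℕ.∣_) (abs-* i j) (∣⇒∣ᵤ r∣ij))
  ... | inj₁ r∣i = inj₁ (∣ᵤ⇒∣ r∣i)
  ... | inj₂ r∣j = inj₂ (∣ᵤ⇒∣ r∣j)

  ∣ᵍ-•⁻ : ∀ {r} k u → Prime r → ¬ (+ r ∣ k) → r ∣ᵍ (k • u) → r ∣ᵍ u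
  ∣ᵍ-•⁻ {r} k (a , b) pr r∤k (r∣ka , r∣kb) = cancel a r∣ka , cancel b r∣kb
    where
    cancel : ∀ x → + r ∣ k * x → + r ∣ x
    cancel x r∣kx with euclid k x pr r∣kx
    ... | inj₁ r∣k = ⊥-elim (r∤k r∣k)
    ... | inj₂ r∣x = r∣x

  Pythagorean : ℕ → Set
  Pythagorean q = Prime q × q % 4 ≡ 1

  -- The property
  -- "r does not divide z π" survives multiplying z by π or by a factor of
  -- norm prime to r; this is the key to the primitivity of products below.
  module OverPrime {r a b : ℕ} (pythagorean : Pythagorean r) (a²+b²≡r : a ℕ.* a ℕ.+ b ℕ.* b ≡ r) where

    π : 𝔾
    π = (+ a , + b)

    norm-π : norm π ≡ + r
    norm-π = begin
      + a * + a + + b * + b           ≡⟨ cong₂ _+_ (pos-* a a) (pos-* b b) ⟨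
      + (a ℕ.* a) + + (b ℕ.* b)       ≡⟨ pos-+ (a ℕ.* a) (b ℕ.* b) ⟨
      + (a ℕ.* a ℕ.+ b ℕ.* b)         ≡⟨ cong +_ a²+b²≡r ⟩
      + r                             ∎
      where open ≡-Reasoning

    prime : Prime r
    prime = proj₁ pythagorean

    1<r : 1 < r
    1<r = ℕ.nonTrivial⇒n>1 r {{prime⇒nonTrivial prime}}

    -- r divides neither a (as 0 < a < r) nor 2 (as r ≡ 1 mod 4), hence not 2a.
    a≢0 : a ≢ 0
    a≢0 a≡0 = prime-not-square b prime (subst (λ x → x ℕ.* x ℕ.+ b ℕ.* b ≡ r) a≡0 a²+b²≡r)

    r∤a : ¬ (+ r ∣ + a)
    r∤a r∣a = ℕ.<⇒≱ 1<r (ℕ.*-cancelˡ-≤ r {{prime⇒nonZero prime}} (begin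
      r ℕ.* r                 ≤⟨ ℕ.*-mono-≤ r≤a r≤a ⟩
      a ℕ.* a                 ≤⟨ ℕ.m≤m+n _ (b ℕ.* b) ⟩
      a ℕ.* a ℕ.+ b ℕ.* b     ≡⟨ a²+b²≡r ⟩
      r                       ≡⟨ ℕ.*-identityʳ r ⟨
      r ℕ.* 1                 ∎))
      where
      open ℕ.≤-Reasoning
      r≤a : r ℕ.≤ a
      r≤a = ℕ.∣⇒≤ {{ℕ.≢-nonZero a≢0}} (∣⇒∣ᵤ r∣a)

    r∤2 : ¬ (+ r ∣ + 2)
    r∤2 r∣2 with ℕ.≤-antisym (ℕ.∣⇒≤ (∣⇒∣ᵤ r∣2)) 1<r | proj₂ pythagorean
    ... | refl | ()

    r∤2a : ¬ (+ r ∣ + 2 * + a)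
    r∤2a r∣2a with euclid (+ 2) (+ a) prime r∣2a
    ... | inj₁ r∣2 = r∤2 r∣2
    ... | inj₂ r∣a = r∤a r∣a

    Indivisible : 𝔾 → Set
    Indivisible z = ¬ (r ∣ᵍ (z · π))

    indivisible-1 : Indivisible 1ᵍ
    indivisible-1 r∣π = r∤a (subst (λ u → + r ∣ proj₁ u) (·-identityˡ π) (proj₁ r∣π))

    -- Since π² = 2a π - r, a further factor π keeps z π indivisible by r.
    indivisible-π : ∀ {z} → Indivisible z → Indivisible (z · π)
    indivisible-π {z} ind r∣zππ = ind (∣ᵍ-•⁻ (+ 2 * + a) (z · π) prime r∤2a
      (subst (r ∣ᵍ_) (·-twice z (+ a) (+ b))
        (∣ᵍ-⊕ (z · π · π) (norm π • z) r∣zππ (∣ᵍ-• (norm π) z (subst (+ r ∣_) (sym norm-π) ∣-refl)))))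

    -- A factor whose norm is prime to r keeps z π indivisible by r:
    -- multiplying by its conjugate gives N(w) z π.
    indivisible-· : ∀ {z} w → Indivisible z → ¬ (+ r ∣ norm w) → Indivisible (z · w)
    indivisible-· {z} w ind r∤Nw r∣zwπ = ind (∣ᵍ-•⁻ (norm w) (z · π) prime r∤Nw
      (subst (r ∣ᵍ_) (·-conj (z · π) w) (∣ᵍ-· (z · π · w) (conj w) (subst (r ∣ᵍ_) reorder r∣zwπ))))
      where
      reorder : z · w · π ≡ z · π · w
      reorder = begin
        z · w · π    ≡⟨ ·-assoc z w π ⟩
        z · (w · π)  ≡⟨ cong (z ·_) (·-comm w π) ⟩
        z · (π · w)  ≡⟨ ·-assoc z π w ⟨
        z · π · w    ∎
        where open ≡-Reasoning

  content : 𝔾 → ℕ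
  content (a , b) = gcd ∣ a ∣ ∣ b ∣

  content-negate : ∀ z → content (negate z) ≡ content z
  content-negate (a , b) = cong₂ gcd (∣-i∣≡∣i∣ a) (∣-i∣≡∣i∣ b)

  content-conj : ∀ z → content (conj z) ≡ content z
  content-conj (a , b) = cong (gcd ∣ a ∣) (∣-i∣≡∣i∣ b)

  content-• : ∀ c z → content (+ c • z) ≡ c ℕ.* content z
  content-• c (a , b) =
    trans (cong₂ gcd (abs-* (+ c) a) (abs-* (+ c) b)) (sym (c*gcd[m,n]≡gcd[cm,cn] c ∣ a ∣ ∣ b ∣))

  coprime-by-primes : ∀ {m n} → ¬ (m ≡ 0 × n ≡ 0) → (∀ {r} → Prime r → r ℕ.∣ m → r ℕ.∣ n → ⊥) →
                      Coprime m n
  coprime-by-primes not-zero no-common {zero} (0∣m , 0∣n) = ⊥-elim (not-zero (ℕ.0∣⇒≡0 0∣m , ℕ.0∣⇒≡0 0∣n))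
  coprime-by-primes not-zero no-common {suc zero} _ = refl
  coprime-by-primes not-zero no-common {d@(suc (suc _))} (d∣m , d∣n) with factorise d
  ... | record { factors = [] ; isFactorisation = () }
  ... | record { factors = r ∷ rs ; isFactorisation = d≡∏ ; factorsPrime = r-prime ∷ _ } =
    ⊥-elim (no-common r-prime (ℕ.∣-trans r∣d d∣m) (ℕ.∣-trans r∣d d∣n))
    where
    r∣d : r ℕ.∣ d
    r∣d = subst (r ℕ.∣_) (sym d≡∏) (∈⇒∣product {ns = r ∷ rs} (here refl))

  module Products
    (π : ℕ → 𝔾)
    (π-spec : ∀ {q} → Pythagorean q → ∃[ a ] ∃[ b ] a ℕ.* a ℕ.+ b ℕ.* b ≡ q × π q ≡ (+ a , + b))
    where

    Π : List ℕ → 𝔾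
    Π []       = 1ᵍ
    Π (q ∷ qs) = π q · Π qs

    norm-π : ∀ {q} → Pythagorean q → norm (π q) ≡ + q
    norm-π {q} pyth with π-spec pyth
    ... | a , b , a²+b²≡q , π-q = trans (cong norm π-q) (OverPrime.norm-π {q} {a} {b} pyth a²+b²≡q)

    norm-Π : ∀ {qs} → All Pythagorean qs → norm (Π qs) ≡ + product qs
    norm-Π [] = refl
    norm-Π {q ∷ qs} (pyth ∷ pyths) = begin
      norm (π q · Π qs)           ≡⟨ norm-· (π q) (Π qs) ⟩
      norm (π q) * norm (Π qs)    ≡⟨ cong₂ _*_ (norm-π pyth) (norm-Π pyths) ⟩
      + q * + product qs          ≡⟨ pos-* q (product qs) ⟨
      + (q ℕ.* product qs)        ∎
      where open ≡-Reasoning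

    Π-++ : ∀ qs ps → Π (qs ++ ps) ≡ Π qs · Π ps
    Π-++ []       ps = sym (·-identityˡ (Π ps))
    Π-++ (q ∷ qs) ps = trans (cong (π q ·_) (Π-++ qs ps)) (sym (·-assoc (π q) (Π qs) (Π ps)))

    Π-↭ : ∀ {qs ps} → qs ↭ ps → Π qs ≡ Π ps
    Π-↭ ↭.refl = refl
    Π-↭ (↭.prep q p) = cong (π q ·_) (Π-↭ p)
    Π-↭ {q ∷ p ∷ qs} {.p ∷ .q ∷ ps} (↭.swap q p σ) = begin
      π q · (π p · Π qs)   ≡⟨ ·-assoc (π q) (π p) (Π qs) ⟨
      π q · π p · Π qs     ≡⟨ cong₂ _·_ (·-comm (π q) (π p)) (Π-↭ σ) ⟩
      π p · π q · Π ps     ≡⟨ ·-assoc (π p) (π q) (Π ps) ⟩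
      π p · (π q · Π ps)   ∎
      where open ≡-Reasoning
    Π-↭ (↭.trans σ τ) = trans (Π-↭ σ) (Π-↭ τ)

    -- For a prime r ≡ 1 (mod 4), r does not divide (Π qs) (π r): the factors
    -- π r are handled by indivisible-π, the others have norm prime to r.
    indivisible-Π : ∀ {r qs} → Pythagorean r → All Pythagorean qs → ¬ (r ∣ᵍ (Π qs · π r))
    indivisible-Π {r} {qs} r-pyth pyths with π-spec r-pyth
    ... | a , b , a²+b²≡r , π-r = subst (λ ρ → ¬ (r ∣ᵍ (Π qs · ρ))) (sym π-r) (go pyths)
      where
      open OverPrime {r} {a} {b} r-pyth a²+b²≡r
        using (Indivisible; indivisible-1; indivisible-π; indivisible-·)
      go : ∀ {qs} → All Pythagorean qs → Indivisible (Π qs)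
      go [] = indivisible-1
      go {q ∷ qs} (q-pyth ∷ pyths) with q ℕ.≟ r
      ... | yes refl = subst Indivisible (·-comm (Π qs) (π q))
                         (subst (λ ρ → Indivisible (Π qs · ρ)) (sym π-r) (indivisible-π {Π qs} (go pyths)))
      ... | no q≢r   = subst Indivisible (·-comm (Π qs) (π q)) (indivisible-· {Π qs} (π q) (go pyths) r∤q)
        where
        r∤q : ¬ (+ r ∣ norm (π q))
        r∤q r∣Nπ with prime⇒irreducible (proj₁ q-pyth) (∣⇒∣ᵤ (subst (+ r ∣_) (norm-π q-pyth) r∣Nπ))
        ... | inj₁ r≡1 = ¬prime[1] (subst Prime r≡1 (proj₁ r-pyth))
        ... | inj₂ r≡q  = q≢r (sym r≡q)

    -- Products of the chosen primes are primitive: a common prime factor r of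
    -- the coordinates divides the norm, so r is one of the qs, and then
    -- r ∣ (Π qs) (π r) contradicts indivisible-Π.
    primitive-Π : ∀ {qs} → All Pythagorean qs → content (Π qs) ≡ 1
    primitive-Π {qs} pyths = coprime⇒gcd≡1 (coprime-by-primes not-zero no-common)
      where
      x = proj₁ (Π qs)
      y = proj₂ (Π qs)
      not-zero : ¬ (∣ x ∣ ≡ 0 × ∣ y ∣ ≡ 0)
      not-zero (x≡0 , y≡0) = ℕ.<⇒≢ (productOfPrimes≥1 (All.map proj₁ pyths)) (sym (+-injective (begin
        + product qs                 ≡⟨ norm-Π pyths ⟨
        x * x + y * y                ≡⟨ cong₂ (λ u v → u * u + v * v) (∣i∣≡0⇒i≡0 {x} x≡0) (∣i∣≡0⇒i≡0 {y} y≡0) ⟩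
        + 0                          ∎)))
        where open ≡-Reasoning
      no-common : ∀ {r} → Prime r → r ℕ.∣ ∣ x ∣ → r ℕ.∣ ∣ y ∣ → ⊥
      no-common {r} r-prime r∣∣x∣ r∣∣y∣ = indivisible-Π r-pyth pyths (∣ᵍ-· (Π qs) (π r) (r∣x , r∣y))
        where
        r∣x : + r ∣ x
        r∣x = ∣ᵤ⇒∣ r∣∣x∣
        r∣y : + r ∣ y
        r∣y = ∣ᵤ⇒∣ r∣∣y∣
        r∣norm : r ℕ.∣ product qs
        r∣norm = ∣⇒∣ᵤ (subst (+ r ∣_) (norm-Π pyths)
                   (∣m∣n⇒∣m+n (∣m⇒∣m*n x r∣x) (∣m⇒∣m*n y r∣y)))
        r-pyth : Pythagorean r
        r-pyth = All.lookup pyths (factorisationHasAllPrimeFactors r-prime r∣norm (All.map proj₁ pyths))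

module DivisorFamily where

  open import Data.Nat as ℕ using (ℕ; zero; suc; _%_; _<_; _/_)
  import Data.Nat.Properties as ℕ
  open import Data.Nat.Divisibility as ℕ using (_∣_; _∣?_)
  open import Data.Nat.DivMod using (m*[n/m]≡n)
  open import Data.Nat.Primality using (Prime; prime?)
  open import Data.Nat.Primality.Factorisation using (PrimeFactorisation; factorise; factorisationUnique)
  open import Data.Nat.ListAction using (product)
  open import Data.Nat.ListAction.Properties using (∈⇒∣product; product-++)
  open import Data.Integer using (+_; _*_)
  open import Data.Integer.Properties using (pos-*)
  open import Data.Product using (_×_; _,_; ∃-syntax)
  open import Data.Sum using (_⊎_; inj₁; inj₂)
  open import Data.Empty using (⊥-elim)
  open import Data.List using (List; []; _++_; map; filter; upTo)
  open import Data.List.Relation.Unary.All as All using (All)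
  import Data.List.Relation.Unary.All.Properties as All
  open import Data.List.Membership.Propositional using (_∈_)
  open import Data.List.Membership.Propositional.Properties using (∈-filter⁺; ∈-filter⁻; ∈-map⁺; ∈-map⁻; ∈-upTo⁺)
  open import Data.List.Relation.Unary.Unique.Propositional using (Unique)
  import Data.List.Relation.Unary.Unique.Propositional.Properties as Unique
  open import Relation.Nullary using (yes; no)
  open import Relation.Binary.Definitions using (tri<; tri≈; tri>)
  open import Function using (_∘_)
  open import Relation.Binary.PropositionalEquality
  open GaussianIntegers
  open Primitivity
  open TwoSquares using (fermat-two-squares)

  -- A Gaussian prime of norm q chosen for each prime q ≡ 1 (mod 4), by
  -- Fermat's two-square theorem (for other q the value is irrelevant).
  gaussian-prime : ℕ → 𝔾
  gaussian-prime q with prime? q | q % 4 ℕ.≟ 1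
  ... | yes q-prime | yes q≡1 = let a , b , _ = fermat-two-squares q-prime q≡1 in (+ a , + b)
  ... | _           | _       = 1ᵍ

  gaussian-prime-spec : ∀ {q} → Pythagorean q →
    ∃[ a ] ∃[ b ] a ℕ.* a ℕ.+ b ℕ.* b ≡ q × gaussian-prime q ≡ (+ a , + b)
  gaussian-prime-spec {q} (q-prime , q≡1) with prime? q | q % 4 ℕ.≟ 1
  ... | yes q-prime′ | yes q≡1′ = let a , b , a²+b²≡q = fermat-two-squares q-prime′ q≡1′ in a , b , a²+b²≡q , refl
  ... | no ¬prime    | _        = ⊥-elim (¬prime q-prime)
  ... | yes _        | no q≢1   = ⊥-elim (q≢1 q≡1)

  open Products gaussian-prime gaussian-prime-spec public

  prime-factors : ℕ → List ℕ
  prime-factors zero    = []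
  prime-factors (suc n) = PrimeFactorisation.factors (factorise (suc n))

  γ : ℕ → 𝔾
  γ m = Π (prime-factors m)

  -- γ is multiplicative, by uniqueness of prime factorisation.
  γ-· : ∀ m n → γ (suc m) · γ (suc n) ≡ γ (suc m ℕ.* suc n)
  γ-· m n = trans (sym (Π-++ (prime-factors (suc m)) (prime-factors (suc n))))
    (Π-↭ (factorisationUnique joint (factorise (suc m ℕ.* suc n))))
    where
    joint : PrimeFactorisation (suc m ℕ.* suc n)
    joint = record
      { factors         = prime-factors (suc m) ++ prime-factors (suc n)
      ; isFactorisation = trans (cong₂ ℕ._*_ (isFactorisation (factorise (suc m))) (isFactorisation (factorise (suc n))))
                                (sym (product-++ (prime-factors (suc m)) (prime-factors (suc n))))
      ; factorsPrime    = All.++⁺ (factorsPrime (factorise (suc m))) (factorsPrime (factorise (suc n)))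
      }
      where open PrimeFactorisation

  square-injective : ∀ {m n} → m ℕ.* m ≡ n ℕ.* n → m ≡ n
  square-injective {m} {n} m²≡n² with ℕ.<-cmp m n
  ... | tri< m<n _ _ = ⊥-elim (ℕ.<⇒≢ (ℕ.*-mono-< m<n m<n) m²≡n²)
  ... | tri≈ _ m≡n _ = m≡n
  ... | tri> _ _ n<m = ⊥-elim (ℕ.<⇒≢ (ℕ.*-mono-< n<m n<m) (sym m²≡n²))

  module DivisorsOf (R : ℕ) (1<R : 1 < R) (hyp : ∀ p → Prime p → p ∣ R → p % 4 ≡ 1) where

    R≢0 : R ≢ 0
    R≢0 R≡0 = ℕ.<⇒≢ (ℕ.<-trans ℕ.z<s 1<R) (sym R≡0)

    pythagorean-factors : ∀ n → suc n ∣ R → All Pythagorean (prime-factors (suc n))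
    pythagorean-factors n n∣R = All.tabulate λ {q} q∈ →
      let q-prime = All.lookup (factorsPrime (factorise (suc n))) q∈ in
      q-prime , hyp q q-prime (ℕ.∣-trans (subst (q ∣_) (sym (isFactorisation (factorise (suc n))))
                                                    (∈⇒∣product q∈)) n∣R)
      where open PrimeFactorisation

    norm-γ : ∀ n → suc n ∣ R → norm (γ (suc n)) ≡ + suc n
    norm-γ n n∣R = trans (norm-Π (pythagorean-factors n n∣R))
      (cong +_ (sym (PrimeFactorisation.isFactorisation (factorise (suc n)))))

    left-∣ : ∀ m n → m ℕ.* n ≡ R → m ∣ R
    left-∣ m n mn≡R = ℕ.divides n (trans (sym mn≡R) (ℕ.*-comm m n))

    right-∣ : ∀ m n → m ℕ.* n ≡ R → n ∣ R
    right-∣ m n mn≡R = ℕ.divides m (sym mn≡R)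

    -- The divisors of R, listed as in the definition of τ.
    divisors : List ℕ
    divisors = filter (_∣? R) (map suc (upTo R))

    divisors-unique : Unique divisors
    divisors-unique = Unique.filter⁺ (_∣? R) (Unique.map⁺ ℕ.suc-injective (Unique.upTo⁺ R))

    ∈-divisors⁻ : ∀ {d} → d ∈ divisors → ∃[ k ] d ≡ suc k × d ∣ R
    ∈-divisors⁻ d∈ with ∈-filter⁻ (_∣? R) {xs = map suc (upTo R)} d∈
    ... | d∈suc , d∣R with ∈-map⁻ suc d∈suc
    ...   | k , _ , refl = k , refl , d∣R

    ∈-divisors⁺ : ∀ k → suc k ∣ R → suc k ∈ divisors
    ∈-divisors⁺ k k∣R = ∈-filter⁺ (_∣? R) (∈-map⁺ suc (∈-upTo⁺ (ℕ.∣⇒≤ {{ℕ.≢-nonZero R≢0}} k∣R))) k∣R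

    -- The complementary divisor R / d (the value at d = 0 is irrelevant).
    cofactor : ℕ → ℕ
    cofactor zero    = 0
    cofactor (suc k) = R / suc k

    Split : ℕ → Set
    Split d = ∃[ k ] ∃[ j ] d ≡ suc k × cofactor d ≡ suc j × suc k ℕ.* suc j ≡ R

    split : ∀ {d} → d ∈ divisors → Split d
    split d∈ with ∈-divisors⁻ d∈
    ... | k , refl , k∣R with R / suc k in e≡
    ...   | zero  = ⊥-elim (R≢0 (trans (sym (m*[n/m]≡n k∣R)) (trans (cong (suc k ℕ.*_) e≡) (ℕ.*-zeroʳ (suc k)))))
    ...   | suc j = k , j , refl , refl , trans (cong (suc k ℕ.*_) (sym e≡)) (m*[n/m]≡n k∣R)

    α : ℕ → 𝔾
    α d = γ d · conj (γ (cofactor d))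

    norm-α : ∀ {d} → d ∈ divisors → norm (α d) ≡ + R
    norm-α {d} d∈ = at (split d∈)
      where
      open ≡-Reasoning
      at : Split d → norm (α d) ≡ + R
      at (k , j , refl , e≡ , kj≡R) = begin
        norm (γ (suc k) · conj (γ (cofactor (suc k))))  ≡⟨ cong (λ c → norm (γ (suc k) · conj (γ c))) e≡ ⟩
        norm (γ (suc k) · conj (γ (suc j)))             ≡⟨ norm-· (γ (suc k)) (conj (γ (suc j))) ⟩
        norm (γ (suc k)) * norm (conj (γ (suc j)))      ≡⟨ cong (norm (γ (suc k)) *_) (norm-conj (γ (suc j))) ⟩
        norm (γ (suc k)) * norm (γ (suc j))             ≡⟨ cong₂ _*_ (norm-γ k (left-∣ (suc k) (suc j) kj≡R)) (norm-γ j (right-∣ (suc k) (suc j) kj≡R)) ⟩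
        + suc k * + suc j                               ≡⟨ pos-* (suc k) (suc j) ⟨
        + (suc k ℕ.* suc j)                             ≡⟨ cong +_ kj≡R ⟩
        + R                                             ∎

    primitive-fourth-power : ∀ j → suc j ∣ R → content (sq (sq (conj (γ (suc j))))) ≡ 1
    primitive-fourth-power j j∣R = begin
      content (sq (sq (conj (γ (suc j)))))   ≡⟨ cong content conj-fourth ⟩
      content (conj (sq (sq (γ (suc j)))))   ≡⟨ content-conj (sq (sq (γ (suc j)))) ⟩
      content (sq (sq (Π fs)))               ≡⟨ cong content fourth-power ⟨
      content (Π ((fs ++ fs) ++ (fs ++ fs))) ≡⟨ primitive-Π (All.++⁺ twice twice) ⟩
      1                                      ∎
      where
      open ≡-Reasoning
      fs = prime-factors (suc j)
      twice = All.++⁺ (pythagorean-factors j j∣R) (pythagorean-factors j j∣R)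
      conj-sq : ∀ h → sq (conj h) ≡ conj (sq h)
      conj-sq h = sym (conj-· h h)
      conj-fourth : sq (sq (conj (γ (suc j)))) ≡ conj (sq (sq (γ (suc j))))
      conj-fourth = trans (cong sq (conj-sq (γ (suc j)))) (conj-sq (sq (γ (suc j))))
      fourth-power : Π ((fs ++ fs) ++ (fs ++ fs)) ≡ sq (sq (Π fs))
      fourth-power = trans (Π-++ (fs ++ fs) (fs ++ fs)) (cong sq (Π-++ fs fs))

    -- Multiplying α_d² by conj(γ_R)² isolates d: since γ_R = γ_d γ_{R/d},
    -- conj(γ_R) α_d = d · conj(γ_{R/d})², whose square has content d².
    isolated : ∀ {d} → d ∈ divisors → content (sq (conj (γ R)) · sq (α d)) ≡ d ℕ.* d
    isolated {d} d∈ = at (split d∈)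
      where
      open ≡-Reasoning
      at : Split d → content (sq (conj (γ R)) · sq (α d)) ≡ d ℕ.* d
      at (k , j , refl , e≡ , kj≡R) = begin
        content (sq (conj (γ R)) · sq (α (suc k)))           ≡⟨ cong content (sq-· (conj (γ R)) (α (suc k))) ⟩
        content (sq (conj (γ R) · α (suc k)))                ≡⟨ cong₂ (λ u v → content (sq (conj u · v))) γ-R α-d ⟩
        content (sq (conj (g · h) · (g · conj h)))           ≡⟨ cong (content ∘ sq) (conj-pair g h) ⟩
        content (sq (norm g • sq (conj h)))                  ≡⟨ cong (λ n → content (sq (n • sq (conj h)))) (norm-γ k (left-∣ (suc k) (suc j) kj≡R)) ⟩
        content (sq (+ suc k • sq (conj h)))                 ≡⟨ cong content (sq-• (+ suc k) (sq (conj h))) ⟩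
        content ((+ suc k * + suc k) • sq (sq (conj h)))     ≡⟨ cong (λ n → content (n • sq (sq (conj h)))) (pos-* (suc k) (suc k)) ⟨
        content (+ (suc k ℕ.* suc k) • sq (sq (conj h)))     ≡⟨ content-• (suc k ℕ.* suc k) (sq (sq (conj h))) ⟩
        suc k ℕ.* suc k ℕ.* content (sq (sq (conj h)))       ≡⟨ cong (suc k ℕ.* suc k ℕ.*_) (primitive-fourth-power j (right-∣ (suc k) (suc j) kj≡R)) ⟩
        suc k ℕ.* suc k ℕ.* 1                                ≡⟨ ℕ.*-identityʳ (suc k ℕ.* suc k) ⟩
        suc k ℕ.* suc k                                      ∎
        where
        g = γ (suc k)
        h = γ (suc j)
        γ-R : γ R ≡ g · h
        γ-R = trans (cong γ (sym kj≡R)) (sym (γ-· k j))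
        α-d : α (suc k) ≡ g · conj h
        α-d = cong (λ c → g · conj (γ c)) e≡

    separated : ∀ {d e} → d ∈ divisors → e ∈ divisors →
                sq (α d) ≡ sq (α e) ⊎ sq (α d) ≡ negate (sq (α e)) → d ≡ e
    separated {d} {e} d∈ e∈ squares≡ =
      square-injective (trans (sym (isolated {d} d∈)) (trans (same-content squares≡) (isolated {e} e∈)))
      where
      open ≡-Reasoning
      same-content : sq (α d) ≡ sq (α e) ⊎ sq (α d) ≡ negate (sq (α e)) →
                     content (sq (conj (γ R)) · sq (α d)) ≡ content (sq (conj (γ R)) · sq (α e))
      same-content (inj₁ eq) = cong (λ w → content (sq (conj (γ R)) · w)) eq
      same-content (inj₂ eq) = begin
        content (sq (conj (γ R)) · sq (α d))            ≡⟨ cong (λ w → content (sq (conj (γ R)) · w)) eq ⟩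
        content (sq (conj (γ R)) · negate (sq (α e)))   ≡⟨ cong content (·-negate (sq (conj (γ R))) (sq (α e))) ⟩
        content (negate (sq (conj (γ R)) · sq (α e)))   ≡⟨ content-negate (sq (conj (γ R)) · sq (α e)) ⟩
        content (sq (conj (γ R)) · sq (α e))            ∎

    1∈divisors : 1 ∈ divisors
    1∈divisors = ∈-divisors⁺ 0 (ℕ.1∣ R)

    R∈divisors : R ∈ divisors
    R∈divisors = divisor-itself R refl
      where
      divisor-itself : ∀ n → n ≡ R → n ∈ divisors
      divisor-itself zero    0≡R = ⊥-elim (R≢0 (sym 0≡R))
      divisor-itself (suc n) n≡R = ∈-divisors⁺ n (subst (suc n ∣_) n≡R ℕ.∣-refl)

open import Defs
open import Data.Nat using (ℕ; _*_; _<_; _%_)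
open import Data.Nat.Divisibility using (_∣_)
open import Data.Nat.Primality using (Prime)
open import Data.Product using (_×_; _,_; ∃-syntax)
open import Data.List using (List; length; _∷_)
open import Data.List.Membership.Propositional using (_∈_)
open import Relation.Binary.PropositionalEquality using (_≡_)
open import Data.Nat.Properties using (<⇒≢)
open Configuration using (module FromSquares)
open DivisorFamily using (module DivisorsOf)

-- The divisors d of R with the Gaussian integers α_d satisfy the hypotheses
-- of FromSquares (1 and R being two different divisors), and the list of
-- divisors is the one counted by τ R.
mainTheorem4 : (R : ℕ) → 1 < R → (∀ p → Prime p → p ∣ R → p % 4 ≡ 1) →
    ∃[ c ] ∃[ pts ]
      ( length pts ≡ 2 * τ R
      × (∀ {P} → P ∈ pts → HasDist P c R)
      × IsIntegralPointSet (c ∷ pts)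
      × (∀ {P Q} → P ∈ pts → Q ∈ pts → ∃[ k ] HasDist P Q (2 * k))
      × HasDiameter (c ∷ pts) (2 * R) )
mainTheorem4 R 1<R hyp = configuration
  where
  open DivisorsOf R 1<R hyp
  open FromSquares R R≢0 divisors divisors-unique α norm-α separated
    1∈divisors R∈divisors (<⇒≢ 1<R)
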